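{- Let $G=(V,E)$ be a finite simple undirected graph with $V=\{1,\dots,n\}$. For $i,j\in V$ let $a_{ij}=1$ if $i=j$ or $d(i,j)=2$, and $a_{ij}=0$ otherwise; and let $b_{ij}=-1$ if $i=j$, $b_{ij}=1$ if $ij\in E$, and $b_{ij}=0$ otherwise. Then the optimal value of the integer program $$\min \sum_{i=1}^n x_i \ \text{ s.t. }\ \sum_{j=1,\,j\ne i}^n a_{ij}x_j\ge 1,\ \ \sum_{j=1}^n b_{ij}x_j<\deg_G(i),\ \ x_i\in\{0,1\}\quad(\forall i\in V)$$ equals the total restrained hop domination number $\gamma_{trh}(G)$.
   Context: $d(u,v)$ is the distance in $G$; $\deg_G(i)$ is the number of neighbours of $i$. A set $S\subseteq V$ is a 2-step dominating set if for every $i\in V$ there is $j\in S$ with $d(i,j)=2$. A 2-step dominating set $S$ is a total restrained hop dominating set if for every $u\in V\setminus S$ there exists $v\in V\setminus S$ with $d(u,v)=1$. $\gamma_{trh}(G)$ is the minimum cardinality of a total restrained hop dominating set of $G$. -}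

module Defs where

open import Data.Nat using (ℕ; zero; suc; _<_)
open import Data.Integer using (ℤ; +_; -_; _*_; _+_)
open import Data.Fin using (Fin; zero; suc; _≟_)
open import Data.Fin.Subset using (Subset; _∈_; _∉_; ∣_∣)
open import Data.Bool using (Bool; true; false; if_then_else_)
open import Data.Product using (Σ; _×_; ∃)
open import Data.Sum using (_⊎_)
open import Relation.Nullary using (¬_; does)
open import Relation.Binary.PropositionalEquality using (_≡_)

record Graph (n : ℕ) : Set where
  field
    adj   : Fin n → Fin n → Bool
    sym   : ∀ i j → adj i j ≡ adj j i
    irrefl : ∀ i → adj i i ≡ false
open Graph public

Edge : ∀ {n} → Graph n → Fin n → Fin n → Set
Edge G i j = adj G i j ≡ true

data Walk {n} (G : Graph n) : Fin n → Fin n → ℕ → Set where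
  here : ∀ {i} → Walk G i i zero
  step : ∀ {i j k m} → Edge G i j → Walk G j k m → Walk G i k (suc m)

Dist : ∀ {n} → Graph n → Fin n → Fin n → ℕ → Set
Dist G i j m = Walk G i j m × (∀ k → k < m → ¬ Walk G i j k)

∑ : ∀ {n} → (Fin n → ℤ) → ℤ
∑ {zero} f = + 0
∑ {suc n} f = f zero + ∑ (λ j → f (suc j))

∑ℕ : ∀ {n} → (Fin n → ℕ) → ℕ
∑ℕ {zero} f = 0
∑ℕ {suc n} f = f zero Data.Nat.+ ∑ℕ (λ j → f (suc j))

deg : ∀ {n} → Graph n → Fin n → ℕ
deg G i = ∑ℕ (λ j → if adj G i j then 1 else 0)

IsAMatrix : ∀ {n} → Graph n → (Fin n → Fin n → ℤ) → Set
IsAMatrix G a = ∀ i j →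
  (a i j ≡ + 1 × (i ≡ j ⊎ Dist G i j 2)) ⊎ (a i j ≡ + 0 × ¬ (i ≡ j ⊎ Dist G i j 2))

bMat : ∀ {n} → Graph n → Fin n → Fin n → ℤ
bMat G i j = if does (i ≟ j) then - (+ 1) else (if adj G i j then + 1 else + 0)

Feasible : ∀ {n} → Graph n → (Fin n → Fin n → ℤ) → (Fin n → ℤ) → Set
Feasible G a x =
  (∀ i → x i ≡ + 0 ⊎ x i ≡ + 1) ×
  (∀ i → + 1 Data.Integer.≤ ∑ (λ j → if does (j ≟ i) then + 0 else a i j * x j)) ×
  (∀ i → ∑ (λ j → bMat G i j * x j) Data.Integer.< + deg G i)

objective : ∀ {n} → (Fin n → ℤ) → ℤ
objective x = ∑ x

IPOptimal : ∀ {n} → Graph n → (Fin n → Fin n → ℤ) → ℤ → Set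
IPOptimal G a v =
  Σ _ (λ x → Feasible G a x × objective x ≡ v) ×
  (∀ x → Feasible G a x → v Data.Integer.≤ objective x)

TwoStepDom : ∀ {n} → Graph n → Subset n → Set
TwoStepDom G S = ∀ i → ∃ λ j → j ∈ S × Dist G i j 2

TRHDSet : ∀ {n} → Graph n → Subset n → Set
TRHDSet G S = TwoStepDom G S × (∀ u → u ∉ S → ∃ λ v → v ∉ S × Dist G u v 1)

IsGammaTRH : ∀ {n} → Graph n → ℕ → Set
IsGammaTRH G k =
  Σ _ (λ S → TRHDSet G S × ∣ S ∣ ≡ k) × (∀ S → TRHDSet G S → k Data.Nat.≤ ∣ S ∣)

{-# OPTIONS --safe #-}
-- A 0/1 vector x is the characteristic vector χ S of the set S of its ones, with objective
-- value ∣ S ∣. Row i of the first constraint sums the ones of x at distance 2 from i, so it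
-- says that S hop-dominates i. Row i of the second reads −χ S i + ∣N(i) ∩ S∣ < ∣N(i)∣, which
-- holds outright when i ∈ S and otherwise says that some neighbour of i lies outside S.
-- Feasible points and total restrained hop dominating sets thus correspond with equal
-- objective and cardinality, so the two minima coincide.
module Submission where

open import Defs hiding (sym)
open import Data.Nat using (ℕ)
open import Data.Integer using (ℤ; +_)
open import Data.Fin using (Fin)
open import Data.Product using (Σ; _×_)
open import Function.Bundles using (_⇔_)
open import Relation.Binary.PropositionalEquality using (_≡_)

import Data.Nat as ℕ
import Data.Nat.Properties as ℕ
open import Data.Integer using (-_; _+_; _*_; _≤_; _<_; +≤+; +<+; -<+) renaming (_≟_ to _≟ℤ_)
import Data.Integer.Properties as ℤP
open import Algebra.Properties.CommutativeSemigroup ℤP.+-commutativeSemigroup using (x∙yz≈y∙xz)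
open import Data.Bool using (Bool; true; false; if_then_else_; _∧_)
open import Data.Empty using (⊥-elim)
open import Data.Fin using (zero; suc; _≟_)
open import Data.Fin.Subset using (Subset; _∈_; _∉_; ∣_∣)
open import Data.Fin.Properties using (suc-injective)
open import Data.Product using (∃; _,_; proj₁)
open import Data.Product.Function.Dependent.Propositional using (Σ-⇔)
open import Data.Sum using (_⊎_; inj₁; inj₂)
open import Data.Vec using ([]; _∷_; lookup; tabulate)
open import Data.Vec.Properties using (lookup∘tabulate; []=⇒lookup; lookup⇒[]=)
open import Function using (_∘_)
open import Function.Bundles using (mk⇔; Equivalence)
open import Function.Construct.Composition using (_⇔-∘_)
open import Function.Construct.Identity using (↠-id)
open import Relation.Binary.PropositionalEquality
  using (_≢_; _≗_; refl; sym; trans; cong; cong₂; subst; subst₂; module ≡-Reasoning)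
open import Relation.Nullary using (does; yes; no; contradiction)

open Equivalence using (to; from)

∑-cong : ∀ {n} {f g : Fin n → ℤ} → f ≗ g → ∑ f ≡ ∑ g
∑-cong {ℕ.zero}  f≗g = refl
∑-cong {ℕ.suc n} f≗g = cong₂ _+_ (f≗g zero) (∑-cong (f≗g ∘ suc))

∑-+ : ∀ {n} (g : Fin n → ℕ) → ∑ (λ j → + g j) ≡ + ∑ℕ g
∑-+ {ℕ.zero}  g = refl
∑-+ {ℕ.suc n} g = trans (cong (_+_ (+ g zero)) (∑-+ (g ∘ suc))) (sym (ℤP.pos-+ (g zero) _))

∑-≡0⊎∃ : ∀ {n} (f : Fin n → ℤ) (P : Fin n → Set) →
         (∀ j → f j ≡ + 0 ⊎ P j) → ∑ f ≡ + 0 ⊎ ∃ P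
∑-≡0⊎∃ {ℕ.zero}  f P f0⊎P = inj₁ refl
∑-≡0⊎∃ {ℕ.suc n} f P f0⊎P with f0⊎P zero | ∑-≡0⊎∃ (f ∘ suc) (P ∘ suc) (f0⊎P ∘ suc)
... | inj₂ p   | _              = inj₂ (zero , p)
... | inj₁ _   | inj₂ (j , p)   = inj₂ (suc j , p)
... | inj₁ f₀≡0 | inj₁ rest≡0   = inj₁ (cong₂ _+_ f₀≡0 rest≡0)

∑-nonneg : ∀ {n} (f : Fin n → ℤ) → (∀ j → + 0 ≤ f j) → + 0 ≤ ∑ f
∑-nonneg {ℕ.zero}  f f≥0 = +≤+ ℕ.z≤n
∑-nonneg {ℕ.suc n} f f≥0 = ℤP.+-mono-≤ (f≥0 zero) (∑-nonneg (f ∘ suc) (f≥0 ∘ suc))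

1≤term⇒1≤∑ : ∀ {n} (f : Fin n → ℤ) → (∀ j → + 0 ≤ f j) → ∀ j → + 1 ≤ f j → + 1 ≤ ∑ f
1≤term⇒1≤∑ f f≥0 zero    1≤f₀ = ℤP.+-mono-≤ 1≤f₀ (∑-nonneg (f ∘ suc) (f≥0 ∘ suc))
1≤term⇒1≤∑ f f≥0 (suc j) 1≤fⱼ = ℤP.+-mono-≤ (f≥0 zero) (1≤term⇒1≤∑ (f ∘ suc) (f≥0 ∘ suc) j 1≤fⱼ)

1≤∑⇔∃≡1 : ∀ {n} (f : Fin n → ℤ) → (∀ j → f j ≡ + 0 ⊎ f j ≡ + 1) →
          + 1 ≤ ∑ f ⇔ ∃ λ j → f j ≡ + 1
1≤∑⇔∃≡1 f f01 = mk⇔ witness (λ (j , fⱼ≡1) → 1≤term⇒1≤∑ f f≥0 j (ℤP.≤-reflexive (sym fⱼ≡1)))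
  where
  f≥0 : ∀ j → + 0 ≤ f j
  f≥0 j with f01 j
  ... | inj₁ fⱼ≡0 = ℤP.≤-reflexive (sym fⱼ≡0)
  ... | inj₂ fⱼ≡1 = subst (+ 0 ≤_) (sym fⱼ≡1) (+≤+ ℕ.z≤n)

  witness : + 1 ≤ ∑ f → ∃ λ j → f j ≡ + 1
  witness 1≤∑ with ∑-≡0⊎∃ f (λ j → f j ≡ + 1) f01
  ... | inj₂ w   = w
  ... | inj₁ ∑≡0 with subst (+ 1 ≤_) ∑≡0 1≤∑
  ...   | +≤+ ()

∑-split : ∀ {n} (f : Fin n → ℤ) (g : Fin n → ℕ) (i : Fin n) → g i ≡ 0 →
          (∀ j → j ≢ i → f j ≡ + g j) → ∑ f ≡ f i + + ∑ℕ g
∑-split {ℕ.suc n} f g zero g₀≡0 f≡g = begin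
    f zero + ∑ (f ∘ suc)
  ≡⟨ cong (_+_ (f zero)) (trans (∑-cong (λ j → f≡g (suc j) λ ())) (∑-+ (g ∘ suc))) ⟩
    f zero + + ∑ℕ (g ∘ suc)
  ≡⟨ cong (λ g₀ → f zero + + (g₀ ℕ.+ ∑ℕ (g ∘ suc))) (sym g₀≡0) ⟩
    f zero + + ∑ℕ g ∎
  where open ≡-Reasoning
∑-split {ℕ.suc n} f g (suc i) gᵢ≡0 f≡g = begin
    f zero + ∑ (f ∘ suc)
  ≡⟨ cong₂ _+_ (f≡g zero λ ()) (∑-split (f ∘ suc) (g ∘ suc) i gᵢ≡0 (λ j j≢i → f≡g (suc j) (j≢i ∘ suc-injective))) ⟩
    + g zero + (f (suc i) + + rest)
  ≡⟨ x∙yz≈y∙xz (+ g zero) (f (suc i)) (+ rest) ⟩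
    f (suc i) + (+ g zero + + rest)
  ≡⟨ cong (_+_ (f (suc i))) (sym (ℤP.pos-+ (g zero) rest)) ⟩
    f (suc i) + + ∑ℕ g ∎
  where
  open ≡-Reasoning
  rest : ℕ
  rest = ∑ℕ (g ∘ suc)

∑ℕ-mono-≤ : ∀ {n} (c d : Fin n → ℕ) → (∀ j → c j ℕ.≤ d j) → ∑ℕ c ℕ.≤ ∑ℕ d
∑ℕ-mono-≤ {ℕ.zero}  c d c≤d = ℕ.z≤n
∑ℕ-mono-≤ {ℕ.suc n} c d c≤d = ℕ.+-mono-≤ (c≤d zero) (∑ℕ-mono-≤ (c ∘ suc) (d ∘ suc) (c≤d ∘ suc))

∑ℕ-mono-< : ∀ {n} (c d : Fin n → ℕ) → (∀ j → c j ℕ.≤ d j) → ∀ j → c j ℕ.< d j → ∑ℕ c ℕ.< ∑ℕ d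
∑ℕ-mono-< c d c≤d zero    c₀<d₀ = ℕ.+-mono-<-≤ c₀<d₀ (∑ℕ-mono-≤ (c ∘ suc) (d ∘ suc) (c≤d ∘ suc))
∑ℕ-mono-< c d c≤d (suc j) cⱼ<dⱼ = ℕ.+-mono-≤-< (c≤d zero) (∑ℕ-mono-< (c ∘ suc) (d ∘ suc) (c≤d ∘ suc) j cⱼ<dⱼ)

∑ℕ-<⇒∃< : ∀ {n} (c d : Fin n → ℕ) → (∀ j → c j ℕ.≤ d j) → ∑ℕ c ℕ.< ∑ℕ d → ∃ λ j → c j ℕ.< d j
∑ℕ-<⇒∃< {ℕ.zero}  c d c≤d ()
∑ℕ-<⇒∃< {ℕ.suc n} c d c≤d ∑c<∑d with c zero ℕ.<? d zero
... | yes c₀<d₀ = zero , c₀<d₀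
... | no c₀≮d₀ with ∑ℕ-<⇒∃< (c ∘ suc) (d ∘ suc) (c≤d ∘ suc) rest<
  where
  rest< : ∑ℕ (c ∘ suc) ℕ.< ∑ℕ (d ∘ suc)
  rest< = ℕ.+-cancelˡ-< (c zero) _ _ (ℕ.<-≤-trans ∑c<∑d (ℕ.+-monoˡ-≤ _ (ℕ.≮⇒≥ c₀≮d₀)))
...   | j , cⱼ<dⱼ = suc j , cⱼ<dⱼ

indicator : Bool → ℕ
indicator b = if b then 1 else 0

indicator-∧-≤ : ∀ p q → indicator (p ∧ q) ℕ.≤ indicator p
indicator-∧-≤ true  true  = ℕ.≤-refl
indicator-∧-≤ true  false = ℕ.z≤n
indicator-∧-≤ false q     = ℕ.z≤n

indicator-∧-<⇔ : ∀ p q → indicator (p ∧ q) ℕ.< indicator p ⇔ (p ≡ true × q ≡ false)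
indicator-∧-<⇔ true  true  = mk⇔ (λ { (ℕ.s≤s ()) }) (λ ())
indicator-∧-<⇔ true  false = mk⇔ (λ _ → refl , refl) (λ _ → ℕ.s≤s ℕ.z≤n)
indicator-∧-<⇔ false q     = mk⇔ (λ ()) (λ ())

count-∧-<⇔ : ∀ {n} (p q : Fin n → Bool) →
             ∑ℕ (λ j → indicator (p j ∧ q j)) ℕ.< ∑ℕ (indicator ∘ p) ⇔
             ∃ λ j → p j ≡ true × q j ≡ false
count-∧-<⇔ p q = mk⇔
  (λ ∑< → let j , j< = ∑ℕ-<⇒∃< _ _ pointwise ∑< in j , to (indicator-∧-<⇔ (p j) (q j)) j<)
  (λ (j , pⱼ , qⱼ) → ∑ℕ-mono-< _ _ pointwise j (from (indicator-∧-<⇔ (p j) (q j)) (pⱼ , qⱼ)))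
  where
  pointwise : ∀ j → indicator (p j ∧ q j) ℕ.≤ indicator (p j)
  pointwise j = indicator-∧-≤ (p j) (q j)

χ : ∀ {n} → Subset n → Fin n → ℤ
χ S j = + indicator (lookup S j)

χ-01 : ∀ {n} (S : Subset n) j → χ S j ≡ + 0 ⊎ χ S j ≡ + 1
χ-01 S j with lookup S j
... | true  = inj₂ refl
... | false = inj₁ refl

∑χ≡∣∣ : ∀ {n} (S : Subset n) → ∑ (χ S) ≡ + ∣ S ∣
∑χ≡∣∣ []          = refl
∑χ≡∣∣ (true ∷ S)  = cong (_+_ (+ 1)) (∑χ≡∣∣ S)
∑χ≡∣∣ (false ∷ S) = cong (_+_ (+ 0)) (∑χ≡∣∣ S)

lookup≡false⇒∉ : ∀ {n} {S : Subset n} {j} → lookup S j ≡ false → j ∉ S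
lookup≡false⇒∉ Sⱼ≡false j∈S with trans (sym ([]=⇒lookup j∈S)) Sⱼ≡false
... | ()

∉⇒lookup≡false : ∀ {n} (S : Subset n) j → j ∉ S → lookup S j ≡ false
∉⇒lookup≡false S j j∉S with lookup S j in Sⱼ
... | true  = contradiction (lookup⇒[]= j S Sⱼ) j∉S
... | false = refl

support : ∀ {n} → (Fin n → ℤ) → Subset n
support x = tabulate (λ j → does (x j ≟ℤ + 1))

χ-support : ∀ {n} (x : Fin n → ℤ) j → x j ≡ + 0 ⊎ x j ≡ + 1 → χ (support x) j ≡ x j
χ-support x j xⱼ01 rewrite lookup∘tabulate (λ j → does (x j ≟ℤ + 1)) j with xⱼ01
... | inj₁ xⱼ≡0 rewrite xⱼ≡0 = refl
... | inj₂ xⱼ≡1 rewrite xⱼ≡1 = refl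

module _ {n} {G : Graph n} where

  Walk-length0⇒≡ : ∀ {i j} → Walk G i j 0 → i ≡ j
  Walk-length0⇒≡ here = refl

  Dist-suc⇒≢ : ∀ {i j m} → Dist G i j (ℕ.suc m) → i ≢ j
  Dist-suc⇒≢ (_ , shortest) refl = shortest 0 (ℕ.s≤s ℕ.z≤n) here

  Edge⇒≢ : ∀ {i j} → Edge G i j → i ≢ j
  Edge⇒≢ {i} ij refl with trans (sym (irrefl G i)) ij
  ... | ()

  Dist1⇔Edge : ∀ {i j} → Dist G i j 1 ⇔ Edge G i j
  Dist1⇔Edge = mk⇔ (λ { (step ij here , _) → ij })
    (λ ij → step ij here , λ { ℕ.zero _ w → Edge⇒≢ ij (Walk-length0⇒≡ w) ; (ℕ.suc _) (ℕ.s≤s ()) _ })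

module HopConstraint {n} {G : Graph n} {a : Fin n → Fin n → ℤ} (isA : IsAMatrix G a)
                     (S : Subset n) (i : Fin n) where

  term : Fin n → ℤ
  term j = if does (j ≟ i) then + 0 else a i j * χ S j

  term-01 : ∀ j → term j ≡ + 0 ⊎ term j ≡ + 1
  term-01 j with j ≟ i
  ... | yes _ = inj₁ refl
  ... | no _ with isA i j
  ...   | inj₁ (aᵢⱼ≡1 , _) rewrite aᵢⱼ≡1 | ℤP.*-identityˡ (χ S j) = χ-01 S j
  ...   | inj₂ (aᵢⱼ≡0 , _) rewrite aᵢⱼ≡0 = inj₁ refl

  term≡1⇔ : ∀ {j} → term j ≡ + 1 ⇔ (j ∈ S × Dist G i j 2)
  term≡1⇔ {j} = mk⇔ hop term≡1
    where
    hop : term j ≡ + 1 → j ∈ S × Dist G i j 2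
    hop tⱼ≡1 with j ≟ i
    hop ()   | yes _
    hop tⱼ≡1 | no j≢i with isA i j
    ... | inj₁ (_ , inj₁ i≡j) = ⊥-elim (j≢i (sym i≡j))
    ... | inj₂ (aᵢⱼ≡0 , _) rewrite aᵢⱼ≡0 with tⱼ≡1
    ...   | ()
    hop tⱼ≡1 | no _ | inj₁ (aᵢⱼ≡1 , inj₂ d) rewrite aᵢⱼ≡1 with lookup S j in Sⱼ | tⱼ≡1
    ...   | true  | _  = lookup⇒[]= j S Sⱼ , d
    ...   | false | ()

    term≡1 : j ∈ S × Dist G i j 2 → term j ≡ + 1
    term≡1 (j∈S , d) with j ≟ i
    ... | yes j≡i = ⊥-elim (Dist-suc⇒≢ d (sym j≡i))
    ... | no _ with isA i j
    ...   | inj₂ (_ , ¬hop) = ⊥-elim (¬hop (inj₂ d))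
    ...   | inj₁ (aᵢⱼ≡1 , _) rewrite aᵢⱼ≡1 | []=⇒lookup j∈S = refl

  constraint⇔ : + 1 ≤ ∑ term ⇔ ∃ λ j → j ∈ S × Dist G i j 2
  constraint⇔ = Σ-⇔ (↠-id _) term≡1⇔ ⇔-∘ 1≤∑⇔∃≡1 term term-01

module RestrainedConstraint {n} (G : Graph n) (S : Subset n) (i : Fin n) where

  neighboursInS : ℕ
  neighboursInS = ∑ℕ (λ j → indicator (adj G i j ∧ lookup S j))

  ∑-bMat-χ : ∑ (λ j → bMat G i j * χ S j) ≡ - + indicator (lookup S i) + + neighboursInS
  ∑-bMat-χ = trans (∑-split _ _ i noLoop offDiagonal) (cong (_+ + neighboursInS) diagonal)
    where
    noLoop : indicator (adj G i i ∧ lookup S i) ≡ 0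
    noLoop rewrite irrefl G i = refl

    offDiagonal : ∀ j → j ≢ i → bMat G i j * χ S j ≡ + indicator (adj G i j ∧ lookup S j)
    offDiagonal j j≢i with i ≟ j | adj G i j | lookup S j
    ... | yes i≡j | _     | _     = ⊥-elim (j≢i (sym i≡j))
    ... | no _    | true  | true  = refl
    ... | no _    | true  | false = refl
    ... | no _    | false | _     = refl

    diagonal : bMat G i i * χ S i ≡ - + indicator (lookup S i)
    diagonal with i ≟ i | lookup S i
    ... | no i≢i | _     = ⊥-elim (i≢i refl)
    ... | yes _  | true  = refl
    ... | yes _  | false = refl

  neighboursInS≤deg : neighboursInS ℕ.≤ deg G i
  neighboursInS≤deg = ∑ℕ-mono-≤ _ _ (λ j → indicator-∧-≤ (adj G i j) (lookup S j))

  outsideNeighbour⇔ : neighboursInS ℕ.< deg G i ⇔ ∃ λ v → v ∉ S × Dist G i v 1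
  outsideNeighbour⇔ = Σ-⇔ (↠-id _) (mk⇔ (λ (iv , Sᵥ) → lookup≡false⇒∉ Sᵥ , from Dist1⇔Edge iv)
                                        (λ (v∉S , d) → to Dist1⇔Edge d , ∉⇒lookup≡false S _ v∉S))
                      ⇔-∘ count-∧-<⇔ (adj G i) (λ j → lookup S j)

  constraint⇔ : ∑ (λ j → bMat G i j * χ S j) < + deg G i ⇔ (i ∉ S → ∃ λ v → v ∉ S × Dist G i v 1)
  constraint⇔ rewrite ∑-bMat-χ with lookup S i in Sᵢ
  ... | true  = mk⇔ (λ _ i∉S → contradiction (lookup⇒[]= i S Sᵢ) i∉S)
                    (λ _ → ℤP.<-≤-trans (ℤP.+-monoˡ-< (+ neighboursInS) -<+) (+≤+ neighboursInS≤deg))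
  ... | false = mk⇔ (λ w _ → w) (λ h → h (lookup≡false⇒∉ Sᵢ))
                ⇔-∘ (outsideNeighbour⇔ ⇔-∘ mk⇔ ℤP.drop‿+<+ +<+)

Feasible-cong : ∀ {n} (G : Graph n) (a : Fin n → Fin n → ℤ) {x y : Fin n → ℤ} →
                x ≗ y → Feasible G a x → Feasible G a y
Feasible-cong G a x≗y (x01 , hop , restrained) =
  (λ i → subst (λ z → z ≡ + 0 ⊎ z ≡ + 1) (x≗y i) (x01 i)) ,
  (λ i → subst (+ 1 ≤_) (∑-cong (λ j → cong (λ z → if does (j ≟ i) then + 0 else a i j * z) (x≗y j))) (hop i)) ,
  (λ i → subst (_< + deg G i) (∑-cong (λ j → cong (bMat G i j *_) (x≗y j))) (restrained i))

χ-feasible⇔ : ∀ {n} {G : Graph n} {a : Fin n → Fin n → ℤ} → IsAMatrix G a →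
              ∀ S → Feasible G a (χ S) ⇔ TRHDSet G S
χ-feasible⇔ {G = G} isA S = mk⇔
  (λ (_ , hop , restrained) → (λ i → to (HopConstraint.constraint⇔ isA S i) (hop i)) ,
                              (λ u → to (RestrainedConstraint.constraint⇔ G S u) (restrained u)))
  (λ (dominating , total) → χ-01 S ,
                            (λ i → from (HopConstraint.constraint⇔ isA S i) (dominating i)) ,
                            (λ u → from (RestrainedConstraint.constraint⇔ G S u) (total u)))

IsMinimumℤ : {X : Set} → (X → Set) → (X → ℤ) → ℤ → Set
IsMinimumℤ {X} P f v = Σ X (λ x → P x × f x ≡ v) × (∀ x → P x → v ≤ f x)

IsMinimumℕ : {Y : Set} → (Y → Set) → (Y → ℕ) → ℕ → Set
IsMinimumℕ {Y} Q g k = Σ Y (λ y → Q y × g y ≡ k) × (∀ y → Q y → k ℕ.≤ g y)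

IsMinimum-transfer : {X Y : Set} (P : X → Set) (f : X → ℤ) (Q : Y → Set) (g : Y → ℕ) →
                     (∀ y → Q y → Σ X λ x → P x × f x ≡ + g y) →
                     (∀ x → P x → Σ Y λ y → Q y × f x ≡ + g y) →
                     ∀ v → IsMinimumℤ P f v ⇔ Σ ℕ (λ k → v ≡ + k × IsMinimumℕ Q g k)
IsMinimum-transfer P f Q g encode decode v = mk⇔ minℤ⇒minℕ minℕ⇒minℤ
  where
  minℤ⇒minℕ : IsMinimumℤ P f v → Σ ℕ (λ k → v ≡ + k × IsMinimumℕ Q g k)
  minℤ⇒minℕ ((x , Px , fx≡v) , v≤) with decode x Px
  ... | y , Qy , fx≡gy = g y , v≡gy , (y , Qy , refl) , gy≤
    where
    v≡gy : v ≡ + g y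
    v≡gy = trans (sym fx≡v) fx≡gy

    gy≤ : ∀ y′ → Q y′ → g y ℕ.≤ g y′
    gy≤ y′ Qy′ with encode y′ Qy′
    ... | x′ , Px′ , fx′≡gy′ = ℤP.drop‿+≤+ (subst₂ _≤_ v≡gy fx′≡gy′ (v≤ x′ Px′))

  minℕ⇒minℤ : Σ ℕ (λ k → v ≡ + k × IsMinimumℕ Q g k) → IsMinimumℤ P f v
  minℕ⇒minℤ (k , refl , (y , Qy , gy≡k) , k≤) with encode y Qy
  ... | x , Px , fx≡gy = (x , Px , trans fx≡gy (cong +_ gy≡k)) , k≤f
    where
    k≤f : ∀ x′ → P x′ → + k ≤ f x′
    k≤f x′ Px′ with decode x′ Px′
    ... | y′ , Qy′ , fx′≡gy′ = subst (+ k ≤_) (sym fx′≡gy′) (+≤+ (k≤ y′ Qy′))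

mainTheorem4 : ∀ {n} (G : Graph n) (a : Fin n → Fin n → ℤ) → IsAMatrix G a →
    (v : ℤ) → IPOptimal G a v ⇔ Σ ℕ (λ k → v ≡ + k × IsGammaTRH G k)
mainTheorem4 {n} G a isA = IsMinimum-transfer (Feasible G a) objective (TRHDSet G) ∣_∣ encode decode
  where
  encode : ∀ S → TRHDSet G S → Σ (Fin n → ℤ) λ x → Feasible G a x × objective x ≡ + ∣ S ∣
  encode S trh = χ S , from (χ-feasible⇔ isA S) trh , ∑χ≡∣∣ S

  decode : ∀ x → Feasible G a x → Σ (Subset n) λ S → TRHDSet G S × objective x ≡ + ∣ S ∣
  decode x feasible = support x ,
                      to (χ-feasible⇔ isA (support x)) (Feasible-cong G a (sym ∘ χ≗x) feasible) ,
                      trans (sym (∑-cong χ≗x)) (∑χ≡∣∣ (support x))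
    where
    χ≗x : χ (support x) ≗ x
    χ≗x j = χ-support x j (proj₁ feasible j)
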